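{- Let $0<\gamma<1$, let $N=(V,E)$ be a network, and let $\Gamma$ be a CPM($\gamma$)-optimal clustering of $N$. If $E'\subseteq E$ is obtained from $E$ by removing some edges whose endpoints lie in different clusters of $\Gamma$, then $\Gamma$ is a CPM($\gamma$)-optimal clustering of $(V,E')$.
   Context: A network is a finite simple undirected unweighted graph $N=(V,E)$; a clustering is a partition of $V$ into nonempty clusters. For $0<\gamma<1$ the CPM($\gamma$) score of a clustering $\mathcal{C}$ is $\mathcal{H}_\gamma(\mathcal{C})=\sum_{c\in\mathcal{C}}\left(e_c-\gamma\binom{|c|}{2}\right)$, where $e_c$ is the number of edges with both endpoints in $c$; a clustering is CPM($\gamma$)-optimal if it maximizes $\mathcal{H}_\gamma$ over all partitions of $V$.
   Formalization: The parameter γ ranges over the rationals in the open interval (0,1). -}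

module Defs where

open import Data.Nat as ℕ using (ℕ)
open import Data.Nat.Combinatorics using (_C_)
open import Data.Bool using (Bool; true; false; _∧_; if_then_else_)
open import Data.Fin using (Fin; _<?_)
open import Data.Fin.Properties using (_≟_)
open import Data.List using (List; foldr; map; allFin)
open import Data.Rational as ℚ using (ℚ; _+_; _-_; _*_; _≤_; _<_; 0ℚ; 1ℚ)
open import Data.Integer using (+_)
open import Relation.Nullary.Decidable using (⌊_⌋)
open import Relation.Binary.PropositionalEquality using (_≡_; _≢_)

record Network (n : ℕ) : Set where
  field
    adj   : Fin n → Fin n → Bool
    sym   : ∀ i j → adj i j ≡ adj j i
    irrefl : ∀ i → adj i i ≡ false
open Network public

-- A clustering of Fin n is given by a cluster label for each vertex; the clusters
-- are the nonempty fibres of the labelling. Every partition of Fin n (which has at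
-- most n blocks) arises this way.
Clustering : ℕ → Set
Clustering n = Fin n → Fin n

Σℕ : ∀ {n} → (Fin n → ℕ) → ℕ
Σℕ {n} f = foldr ℕ._+_ 0 (map f (allFin n))

Σℚ : ∀ {n} → (Fin n → ℚ) → ℚ
Σℚ {n} f = foldr _+_ 0ℚ (map f (allFin n))

ℕ→ℚ : ℕ → ℚ
ℕ→ℚ m = (+ m) ℚ./ 1

[_] : Bool → ℕ
[ true ] = 1
[ false ] = 0

inCluster : ∀ {n} → Clustering n → Fin n → Fin n → Bool
inCluster cl k i = ⌊ cl i ≟ k ⌋

clusterSize : ∀ {n} → Clustering n → Fin n → ℕ
clusterSize cl k = Σℕ λ i → [ inCluster cl k i ]

clusterEdges : ∀ {n} → Network n → Clustering n → Fin n → ℕ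
clusterEdges N cl k =
  Σℕ λ i → Σℕ λ j → [ ⌊ i <? j ⌋ ∧ adj N i j ∧ inCluster cl k i ∧ inCluster cl k j ]

-- CPM(γ) score: Σ_c (e_c - γ * binom(|c|,2)); empty labels contribute 0.
cpm : ∀ {n} → ℚ → Network n → Clustering n → ℚ
cpm γ N cl = Σℚ λ k →
  (ℕ→ℚ (clusterEdges N cl k)) - γ * ℕ→ℚ ((clusterSize cl k) C 2)

CPMOptimal : ∀ {n} → ℚ → Network n → Clustering n → Set
CPMOptimal γ N Γ = ∀ (cl : Clustering _) → cpm γ N cl ≤ cpm γ N Γ

-- The score of a fixed clustering changes only through its intra-cluster edge counts e_c.
-- Deleting edges never increases any e_c, so no clustering scores better on (V,E') than on
-- (V,E); and the deleted edges run between clusters of Γ, so Γ keeps all its e_c and hence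
-- its score. Thus for every clustering C, H'(C) ≤ H(C) ≤ H(Γ) = H'(Γ).
module Submission where

open import Defs
open import Data.Nat using (ℕ)
open import Data.Bool using (true; false)
open import Data.Fin using (Fin)
open import Data.Rational using (ℚ; _<_; 0ℚ; 1ℚ)
open import Relation.Binary.PropositionalEquality using (_≡_; _≢_)

import Data.Nat as ℕ
import Data.Nat.Properties as ℕ
open import Data.Nat.Divisibility using (∣1⇒≡1)
open import Data.Bool using (_∧_)
open import Data.Bool.Properties using (∧-zeroʳ)
open import Data.Fin using (_<?_)
open import Data.Fin.Properties using (_≟_)
open import Data.List using ([]; _∷_; foldr; map; allFin)
import Data.Rational as ℚ
import Data.Rational.Properties as ℚ
import Data.Integer as ℤ
import Data.Integer.Properties as ℤ
open import Data.Product using (_,_)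
open import Data.Empty using (⊥-elim)
open import Relation.Nullary using (yes; no)
open import Relation.Nullary.Decidable using (⌊_⌋)
open import Relation.Binary.PropositionalEquality using (refl; cong₂; subst₂)
import Relation.Binary.PropositionalEquality as ≡

module _ {a} {A : Set a} where

  sum-mono-≤ : {f g : A → ℕ} → (∀ x → f x ℕ.≤ g x) →
               ∀ xs → foldr ℕ._+_ 0 (map f xs) ℕ.≤ foldr ℕ._+_ 0 (map g xs)
  sum-mono-≤ f≤g []       = ℕ.z≤n
  sum-mono-≤ f≤g (x ∷ xs) = ℕ.+-mono-≤ (f≤g x) (sum-mono-≤ f≤g xs)

  sum-cong : {f g : A → ℕ} → (∀ x → f x ≡ g x) →
             ∀ xs → foldr ℕ._+_ 0 (map f xs) ≡ foldr ℕ._+_ 0 (map g xs)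
  sum-cong f≗g []       = refl
  sum-cong f≗g (x ∷ xs) = cong₂ ℕ._+_ (f≗g x) (sum-cong f≗g xs)

  sumℚ-mono-≤ : {f g : A → ℚ} → (∀ x → f x ℚ.≤ g x) →
                ∀ xs → foldr ℚ._+_ 0ℚ (map f xs) ℚ.≤ foldr ℚ._+_ 0ℚ (map g xs)
  sumℚ-mono-≤ f≤g []       = ℚ.≤-refl
  sumℚ-mono-≤ f≤g (x ∷ xs) = ℚ.+-mono-≤ (f≤g x) (sumℚ-mono-≤ f≤g xs)

  sumℚ-cong : {f g : A → ℚ} → (∀ x → f x ≡ g x) →
              ∀ xs → foldr ℚ._+_ 0ℚ (map f xs) ≡ foldr ℚ._+_ 0ℚ (map g xs)
  sumℚ-cong f≗g []       = refl
  sumℚ-cong f≗g (x ∷ xs) = cong₂ ℚ._+_ (f≗g x) (sumℚ-cong f≗g xs)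

Σℕ-mono-≤ : ∀ {n} {f g : Fin n → ℕ} → (∀ i → f i ℕ.≤ g i) → Σℕ f ℕ.≤ Σℕ g
Σℕ-mono-≤ {n} f≤g = sum-mono-≤ f≤g (allFin n)

Σℕ-cong : ∀ {n} {f g : Fin n → ℕ} → (∀ i → f i ≡ g i) → Σℕ f ≡ Σℕ g
Σℕ-cong {n} f≗g = sum-cong f≗g (allFin n)

Σℚ-mono-≤ : ∀ {n} {f g : Fin n → ℚ} → (∀ i → f i ℚ.≤ g i) → Σℚ f ℚ.≤ Σℚ g
Σℚ-mono-≤ {n} f≤g = sumℚ-mono-≤ f≤g (allFin n)

Σℚ-cong : ∀ {n} {f g : Fin n → ℚ} → (∀ i → f i ≡ g i) → Σℚ f ≡ Σℚ g
Σℚ-cong {n} f≗g = sumℚ-cong f≗g (allFin n)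

[]-mono : ∀ {a b} → (a ≡ true → b ≡ true) → [ a ] ℕ.≤ [ b ]
[]-mono {false}     a⇒b = ℕ.z≤n
[]-mono {true}  {b} a⇒b with a⇒b refl
... | refl = ℕ.≤-refl

ℕ→ℚ≡mkℚ : ∀ m → ℕ→ℚ m ≡ ℚ.mkℚ (ℤ.+ m) 0 (λ (_ , i∣1) → ∣1⇒≡1 i∣1)
ℕ→ℚ≡mkℚ m = ℚ.normalize-coprime {m} {0} (λ (_ , i∣1) → ∣1⇒≡1 i∣1)

ℕ→ℚ-mono-≤ : ∀ {m k} → m ℕ.≤ k → ℕ→ℚ m ℚ.≤ ℕ→ℚ k
ℕ→ℚ-mono-≤ {m} {k} m≤k rewrite ℕ→ℚ≡mkℚ m | ℕ→ℚ≡mkℚ k =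
  ℚ.*≤* (subst₂ ℤ._≤_ (≡.sym (ℤ.*-identityʳ (ℤ.+ m))) (≡.sym (ℤ.*-identityʳ (ℤ.+ k))) (ℤ.+≤+ m≤k))

edges-mono-adj : ∀ {n} (N N' : Network n) (cl : Clustering n) →
  (∀ i j → adj N' i j ≡ true → adj N i j ≡ true) →
  ∀ k → clusterEdges N' cl k ℕ.≤ clusterEdges N cl k
edges-mono-adj N N' cl N'⊆N k = Σℕ-mono-≤ λ i → Σℕ-mono-≤ λ j →
  []-mono (∧-mono-middle ⌊ i <? j ⌋ _ (N'⊆N i j))
  where
  ∧-mono-middle : ∀ a r {b c} → (b ≡ true → c ≡ true) → a ∧ b ∧ r ≡ true → a ∧ c ∧ r ≡ true
  ∧-mono-middle true  r {true}  b⇒c r≡true with b⇒c refl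
  ... | refl = r≡true
  ∧-mono-middle true  r {false} b⇒c ()
  ∧-mono-middle false r         b⇒c ()

edges-cong-within : ∀ {n} (N N' : Network n) (cl : Clustering n) →
  (∀ i j → cl i ≡ cl j → adj N' i j ≡ adj N i j) →
  ∀ k → clusterEdges N' cl k ≡ clusterEdges N cl k
edges-cong-within N N' cl agree k =
  Σℕ-cong λ i → Σℕ-cong λ j → ≡.cong (λ b → [ ⌊ i <? j ⌋ ∧ b ]) (summand i j)
  where
  summand : ∀ i j → adj N' i j ∧ inCluster cl k i ∧ inCluster cl k j
                  ≡ adj N i j ∧ inCluster cl k i ∧ inCluster cl k j
  summand i j with cl i ≟ k | cl j ≟ k
  ... | no _     | _        = ≡.trans (∧-zeroʳ (adj N' i j)) (≡.sym (∧-zeroʳ (adj N i j)))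
  ... | yes _    | no _     = ≡.trans (∧-zeroʳ (adj N' i j)) (≡.sym (∧-zeroʳ (adj N i j)))
  ... | yes i∈k  | yes j∈k  = cong₂ _∧_ (agree i j (≡.trans i∈k (≡.sym j∈k))) refl

cpm-mono-adj : ∀ {n} (γ : ℚ) (N N' : Network n) (cl : Clustering n) →
  (∀ i j → adj N' i j ≡ true → adj N i j ≡ true) → cpm γ N' cl ℚ.≤ cpm γ N cl
cpm-mono-adj γ N N' cl N'⊆N =
  Σℚ-mono-≤ λ k → ℚ.+-monoˡ-≤ _ (ℕ→ℚ-mono-≤ (edges-mono-adj N N' cl N'⊆N k))

cpm-cong-within : ∀ {n} (γ : ℚ) (N N' : Network n) (cl : Clustering n) →
  (∀ i j → cl i ≡ cl j → adj N' i j ≡ adj N i j) → cpm γ N' cl ≡ cpm γ N cl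
cpm-cong-within γ N N' cl agree =
  Σℚ-cong λ k → cong₂ ℚ._-_ (≡.cong ℕ→ℚ (edges-cong-within N N' cl agree k)) refl

adj-agree-within : ∀ {n} (N N' : Network n) (Γ : Clustering n) →
  (∀ i j → adj N' i j ≡ true → adj N i j ≡ true) →
  (∀ i j → adj N i j ≡ true → adj N' i j ≡ false → Γ i ≢ Γ j) →
  ∀ i j → Γ i ≡ Γ j → adj N' i j ≡ adj N i j
adj-agree-within N N' Γ N'⊆N removed-between i j same with adj N i j in e | adj N' i j in e'
... | true  | true  = refl
... | false | false = refl
... | true  | false = ⊥-elim (removed-between i j e e' same)
... | false | true  with ≡.trans (≡.sym e) (N'⊆N i j e')
...   | ()

lemma3 : (n : ℕ) (γ : ℚ) → 0ℚ < γ → γ < 1ℚ →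
    (N N' : Network n) (Γ : Clustering n) → CPMOptimal γ N Γ →
    (∀ i j → adj N' i j ≡ true → adj N i j ≡ true) →
    (∀ i j → adj N i j ≡ true → adj N' i j ≡ false → Γ i ≢ Γ j) →
    CPMOptimal γ N' Γ
lemma3 n γ _ _ N N' Γ optimal N'⊆N removed-between cl = begin
  cpm γ N' cl ≤⟨ cpm-mono-adj γ N N' cl N'⊆N ⟩
  cpm γ N cl  ≤⟨ optimal cl ⟩
  cpm γ N Γ   ≡⟨ ≡.sym (cpm-cong-within γ N N' Γ (adj-agree-within N N' Γ N'⊆N removed-between)) ⟩
  cpm γ N' Γ  ∎
  where open ℚ.≤-Reasoning
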